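{- For any integer $d \geq 1$ and any $k \in \{0,\ldots,d-1\}$, we have $\sum_{j=0}^d (-1)^j c_{d,k}(j) = 0$.
   Context: For integers $d \geq 1$ and $k \in \{0,\ldots,d\}$, let $P_{d,k}$ be the polynomial determined by $\sum_{n \geq 0} P_{d,k}(n)\, x^n = \frac{(1+x)^k}{(1-x)^{d+1}}$. The numbers $c_{d,k}(j)$ are defined by $d!\, P_{d,k}(n) = \sum_{j=0}^d c_{d,k}(j)\, n^j$. -}

module Defs where

open import Data.Nat using (ℕ; zero; suc; _∸_) renaming (_+_ to _+ℕ_; _*_ to _*ℕ_)
open import Data.Nat.Base using (_!)
open import Data.Fin using (Fin; toℕ) renaming (zero to fzero; suc to fsuc)
open import Relation.Binary.PropositionalEquality using (_≡_)
open import Data.Integer using (+_)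
open import Data.Rational using (ℚ; 0ℚ; 1ℚ; _+_; _*_; -_; _/_)

Series : Set
Series = ℕ → ℕ

sumUpTo : ℕ → (ℕ → ℕ) → ℕ
sumUpTo zero    f = f 0
sumUpTo (suc n) f = sumUpTo n f +ℕ f (suc n)

_⊛_ : Series → Series → Series
(f ⊛ g) n = sumUpTo n (λ i → f i *ℕ g (n ∸ i))

oneS : Series
oneS zero    = 1
oneS (suc _) = 0

powS : Series → ℕ → Series
powS f zero    = oneS
powS f (suc m) = f ⊛ powS f m

onePlusX : Series
onePlusX zero          = 1
onePlusX (suc zero)    = 1
onePlusX (suc (suc _)) = 0

-- 1/(1-x) = 1 + x + x² + …
geomS : Series
geomS _ = 1

P : ℕ → ℕ → ℕ → ℕ
P d k n = (powS onePlusX k ⊛ powS geomS (suc d)) n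

ℕ→ℚ : ℕ → ℚ
ℕ→ℚ n = (+ n) / 1

_^ℚ_ : ℚ → ℕ → ℚ
q ^ℚ zero  = 1ℚ
q ^ℚ suc m = q * (q ^ℚ m)

sumFin : (m : ℕ) → (Fin m → ℚ) → ℚ
sumFin zero    f = 0ℚ
sumFin (suc m) f = f fzero + sumFin m (λ j → f (fsuc j))

-- "c : Fin (d+1) → ℚ are the coefficients c_{d,k}(0..d)", i.e.
-- d! · P_{d,k}(n) = Σ_{j=0}^{d} c(j) n^j for all n ∈ ℕ
-- (such c exist and are unique, since a polynomial of degree ≤ d is
-- determined by its values on ℕ).
IsCoeffs : (d k : ℕ) → (Fin (suc d) → ℚ) → Set
IsCoeffs d k c = ∀ (n : ℕ) →
  ℕ→ℚ ((d !) *ℕ P d k n) ≡ sumFin (suc d) (λ j → c j * (ℕ→ℚ n ^ℚ toℕ j))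

{-# OPTIONS --safe #-}
-- Expanding (1 + x)^k gives d! P_{d,k}(n) = Σ_i C(k,i) (n − i + 1)⋯(n − i + d), a polynomial
-- in n of degree ≤ d each of whose terms vanishes at n = −1 when k < d.  The polynomial
-- Σ_j c_{d,k}(j) n^j has degree ≤ d as well and agrees with it on ℕ, hence also at −1, where
-- it equals Σ_j (−1)^j c_{d,k}(j).  Degree ≤ d is expressed by the vanishing of the (d+1)-st
-- forward difference, which is exactly what carries agreement on ℕ over to −1.
module Submission where

open import Defs
open import Data.Nat using (ℕ; suc; _≤_; _<_)
open import Data.Fin using (Fin; toℕ)
open import Data.Rational using (ℚ; 0ℚ; 1ℚ; _*_; -_)
open import Relation.Binary.PropositionalEquality using (_≡_)

open import Level using (0ℓ)
open import Function using (_∘_; const)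
open import Relation.Nullary.Decidable using (dec⇒maybe)
open import Data.Sum using (inj₁; inj₂)
open import Data.Nat using (zero; z≤n; s≤s; _!; _∸_) renaming (_+_ to _+ℕ_; _*_ to _*ℕ_)
import Data.Nat.Properties as ℕ
import Data.Nat.Tactic.RingSolver as ℕ-Solver
open import Algebra.Properties.CommutativeSemigroup ℕ.+-commutativeSemigroup
  using () renaming (interchange to +-interchange)
import Data.Integer as ℤ
import Data.Integer.Properties as ℤ
open import Data.Fin using () renaming (zero to fzero; suc to fsuc)
import Data.Fin.Properties as Fin
open import Data.Rational using (_+_; _-_; _≟_; toℚᵘ)
open import Data.Rational.Properties
  using (normalize-coprime; toℚᵘ-injective; toℚᵘ-homo-+; toℚᵘ-homo-*; +-*-commutativeRing;
         +-identityˡ; +-identityʳ; *-identityˡ; *-identityʳ; +-inverseˡ; +-inverseʳ;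
         *-zeroˡ; *-zeroʳ; *-comm)
open import Data.Rational.Unnormalised as ℚᵘ using (mkℚᵘ; *≡*)
import Data.Rational.Unnormalised.Properties as ℚᵘ
open import Data.Nat.Coprimality using (1-coprimeTo) renaming (sym to coprime-sym)
open import Relation.Binary.PropositionalEquality
  using (_≗_; refl; sym; trans; cong; cong₂; subst; module ≡-Reasoning)
open import Tactic.RingSolver using (solve-∀)
open import Tactic.RingSolver.Core.AlmostCommutativeRing
  using (AlmostCommutativeRing; fromCommutativeRing)

ℚ-ring : AlmostCommutativeRing 0ℓ 0ℓ
ℚ-ring = fromCommutativeRing +-*-commutativeRing (λ x → dec⇒maybe (0ℚ ≟ x))

toℚᵘ-ℕ→ℚ : ∀ n → toℚᵘ (ℕ→ℚ n) ≡ mkℚᵘ (ℤ.+ n) 0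
toℚᵘ-ℕ→ℚ n = cong toℚᵘ (normalize-coprime (coprime-sym (1-coprimeTo n)))

ℕ→ℚ-+ : ∀ m n → ℕ→ℚ (m +ℕ n) ≡ ℕ→ℚ m + ℕ→ℚ n
ℕ→ℚ-+ m n = toℚᵘ-injective (begin
  toℚᵘ (ℕ→ℚ (m +ℕ n))                 ≡⟨ toℚᵘ-ℕ→ℚ (m +ℕ n) ⟩
  mkℚᵘ (ℤ.+ (m +ℕ n)) 0                ≈⟨ *≡* (cong (ℤ._* ℤ.+ 1) +-over-1) ⟩
  mkℚᵘ (ℤ.+ m) 0 ℚᵘ.+ mkℚᵘ (ℤ.+ n) 0   ≡⟨ sym (cong₂ ℚᵘ._+_ (toℚᵘ-ℕ→ℚ m) (toℚᵘ-ℕ→ℚ n)) ⟩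
  toℚᵘ (ℕ→ℚ m) ℚᵘ.+ toℚᵘ (ℕ→ℚ n)     ≈⟨ ℚᵘ.≃-sym (toℚᵘ-homo-+ (ℕ→ℚ m) (ℕ→ℚ n)) ⟩
  toℚᵘ (ℕ→ℚ m + ℕ→ℚ n)                ∎)
  where
  open ℚᵘ.≃-Reasoning
  +-over-1 : ℤ.+ (m +ℕ n) ≡ ℤ.+ m ℤ.* ℤ.+ 1 ℤ.+ ℤ.+ n ℤ.* ℤ.+ 1
  +-over-1 = trans (ℤ.pos-+ m n) (sym (cong₂ ℤ._+_ (ℤ.*-identityʳ (ℤ.+ m)) (ℤ.*-identityʳ (ℤ.+ n))))

ℕ→ℚ-* : ∀ m n → ℕ→ℚ (m *ℕ n) ≡ ℕ→ℚ m * ℕ→ℚ n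
ℕ→ℚ-* m n = toℚᵘ-injective (begin
  toℚᵘ (ℕ→ℚ (m *ℕ n))                 ≡⟨ toℚᵘ-ℕ→ℚ (m *ℕ n) ⟩
  mkℚᵘ (ℤ.+ (m *ℕ n)) 0                ≈⟨ *≡* (cong (ℤ._* ℤ.+ 1) (ℤ.pos-* m n)) ⟩
  mkℚᵘ (ℤ.+ m) 0 ℚᵘ.* mkℚᵘ (ℤ.+ n) 0   ≡⟨ sym (cong₂ ℚᵘ._*_ (toℚᵘ-ℕ→ℚ m) (toℚᵘ-ℕ→ℚ n)) ⟩
  toℚᵘ (ℕ→ℚ m) ℚᵘ.* toℚᵘ (ℕ→ℚ n)     ≈⟨ ℚᵘ.≃-sym (toℚᵘ-homo-* (ℕ→ℚ m) (ℕ→ℚ n)) ⟩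
  toℚᵘ (ℕ→ℚ m * ℕ→ℚ n)                ∎)
  where open ℚᵘ.≃-Reasoning

ℕ→ℚ-suc : ∀ n → ℕ→ℚ (suc n) ≡ ℕ→ℚ n + 1ℚ
ℕ→ℚ-suc n = trans (cong ℕ→ℚ (ℕ.+-comm 1 n)) (ℕ→ℚ-+ n 1)

ℕ→ℚ-suc-1 : ∀ n → ℕ→ℚ (suc n) - 1ℚ ≡ ℕ→ℚ n
ℕ→ℚ-suc-1 n = trans (cong (_- 1ℚ) (ℕ→ℚ-suc n)) (lemma (ℕ→ℚ n))
  where
  lemma : ∀ a → a + 1ℚ - 1ℚ ≡ a
  lemma = solve-∀ ℚ-ring

neg-ℕ→ℚ-1 : ∀ n → - ℕ→ℚ n - 1ℚ ≡ - ℕ→ℚ (suc n)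
neg-ℕ→ℚ-1 n = trans (lemma (ℕ→ℚ n)) (cong -_ (sym (ℕ→ℚ-suc n)))
  where
  lemma : ∀ a → - a - 1ℚ ≡ - (a + 1ℚ)
  lemma = solve-∀ ℚ-ring

open ≡-Reasoning

Δ : (ℚ → ℚ) → ℚ → ℚ
Δ f x = f (x + 1ℚ) - f x

-- Δ^(n+1) f vanishes; for a polynomial f this says deg f ≤ n.
data Deg≤ : ℕ → (ℚ → ℚ) → Set where
  Δ-vanishes : ∀ {f} → (∀ x → Δ f x ≡ 0ℚ) → Deg≤ 0 f
  Δ-deg≤     : ∀ {n f} → Deg≤ n (Δ f) → Deg≤ (suc n) f

Δ-cong : ∀ {f g} → f ≗ g → Δ f ≗ Δ g
Δ-cong f≗g x = cong₂ _-_ (f≗g (x + 1ℚ)) (f≗g x)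

Δ-const : ∀ a → Δ (const a) ≗ const 0ℚ
Δ-const a x = +-inverseʳ a

Δ-+ : ∀ f g → Δ (λ x → f x + g x) ≗ (λ x → Δ f x + Δ g x)
Δ-+ f g x = lemma (f (x + 1ℚ)) (g (x + 1ℚ)) (f x) (g x)
  where
  lemma : ∀ a b c d → (a + b) - (c + d) ≡ (a - c) + (b - d)
  lemma = solve-∀ ℚ-ring

Δ-scale : ∀ a f → Δ (λ x → a * f x) ≗ (λ x → a * Δ f x)
Δ-scale a f x = lemma a (f (x + 1ℚ)) (f x)
  where
  lemma : ∀ a b c → a * b - a * c ≡ a * (b - c)
  lemma = solve-∀ ℚ-ring

Δ-shift : ∀ a f → Δ (λ x → f (x + a)) ≗ (λ x → Δ f (x + a))
Δ-shift a f x = cong (λ y → f y - f (x + a)) (lemma x a)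
  where
  lemma : ∀ x a → x + 1ℚ + a ≡ x + a + 1ℚ
  lemma = solve-∀ ℚ-ring

Δ-*x : ∀ f → Δ (λ x → x * f x) ≗ (λ x → x * Δ f x + f (x + 1ℚ))
Δ-*x f x = lemma x (f (x + 1ℚ)) (f x)
  where
  lemma : ∀ x a b → (x + 1ℚ) * a - x * b ≡ x * (a - b) + a
  lemma = solve-∀ ℚ-ring

Deg≤-cong : ∀ {n f g} → f ≗ g → Deg≤ n f → Deg≤ n g
Deg≤-cong f≗g (Δ-vanishes Δf≡0) = Δ-vanishes λ x → trans (sym (Δ-cong f≗g x)) (Δf≡0 x)
Deg≤-cong f≗g (Δ-deg≤ D)        = Δ-deg≤ (Deg≤-cong (Δ-cong f≗g) D)

Deg≤-const : ∀ n a → Deg≤ n (const a)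
Deg≤-const zero    a = Δ-vanishes (Δ-const a)
Deg≤-const (suc n) a = Δ-deg≤ (Deg≤-cong (sym ∘ Δ-const a) (Deg≤-const n 0ℚ))

Deg≤-suc : ∀ {n f} → Deg≤ n f → Deg≤ (suc n) f
Deg≤-suc (Δ-vanishes Δf≡0) = Δ-deg≤ (Deg≤-cong (sym ∘ Δf≡0) (Deg≤-const 0 0ℚ))
Deg≤-suc (Δ-deg≤ D)        = Δ-deg≤ (Deg≤-suc D)

Deg≤-mono : ∀ {m n f} → m ≤ n → Deg≤ m f → Deg≤ n f
Deg≤-mono {n = zero}  z≤n       D          = D
Deg≤-mono {n = suc n} z≤n       D          = Deg≤-suc (Deg≤-mono z≤n D)
Deg≤-mono             (s≤s m≤n) (Δ-deg≤ D) = Δ-deg≤ (Deg≤-mono m≤n D)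

Deg≤-+ : ∀ {n f g} → Deg≤ n f → Deg≤ n g → Deg≤ n (λ x → f x + g x)
Deg≤-+ {f = f} {g} (Δ-vanishes Δf≡0) (Δ-vanishes Δg≡0) = Δ-vanishes λ x → begin
  Δ (λ y → f y + g y) x  ≡⟨ Δ-+ f g x ⟩
  Δ f x + Δ g x          ≡⟨ cong₂ _+_ (Δf≡0 x) (Δg≡0 x) ⟩
  0ℚ + 0ℚ                ≡⟨ +-identityʳ 0ℚ ⟩
  0ℚ                     ∎
Deg≤-+ {f = f} {g} (Δ-deg≤ Df) (Δ-deg≤ Dg) =
  Δ-deg≤ (Deg≤-cong (sym ∘ Δ-+ f g) (Deg≤-+ Df Dg))

Deg≤-scale : ∀ {n f} a → Deg≤ n f → Deg≤ n (λ x → a * f x)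
Deg≤-scale {f = f} a (Δ-vanishes Δf≡0) =
  Δ-vanishes λ x → trans (Δ-scale a f x) (trans (cong (a *_) (Δf≡0 x)) (*-zeroʳ a))
Deg≤-scale {f = f} a (Δ-deg≤ D) = Δ-deg≤ (Deg≤-cong (sym ∘ Δ-scale a f) (Deg≤-scale a D))

Deg≤-shift : ∀ {n f} a → Deg≤ n f → Deg≤ n (λ x → f (x + a))
Deg≤-shift {f = f} a (Δ-vanishes Δf≡0) = Δ-vanishes λ x → trans (Δ-shift a f x) (Δf≡0 (x + a))
Deg≤-shift {f = f} a (Δ-deg≤ D)        = Δ-deg≤ (Deg≤-cong (sym ∘ Δ-shift a f) (Deg≤-shift a D))

Deg≤-*x : ∀ {n f} → Deg≤ n f → Deg≤ (suc n) (λ x → x * f x)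
Deg≤-*x {f = f} D = Δ-deg≤ (Deg≤-cong (sym ∘ Δ-*x f) (Deg≤-+ (x*Δf D) (Deg≤-shift 1ℚ D)))
  where
  x*Δf : ∀ {n} → Deg≤ n f → Deg≤ n (λ x → x * Δ f x)
  x*Δf (Δ-vanishes Δf≡0) =
    Deg≤-cong (λ x → sym (trans (cong (x *_) (Δf≡0 x)) (*-zeroʳ x))) (Deg≤-const 0 0ℚ)
  x*Δf (Δ-deg≤ DΔf) = Deg≤-*x DΔf

Deg≤-*[x+_] : ∀ {n f} a → Deg≤ n f → Deg≤ (suc n) (λ x → f x * (x + a))
Deg≤-*[x+_] {f = f} a D =
  Deg≤-cong (λ x → lemma x a (f x)) (Deg≤-+ (Deg≤-*x D) (Deg≤-suc (Deg≤-scale a D)))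
  where
  lemma : ∀ x a b → x * b + a * b ≡ b * (x + a)
  lemma = solve-∀ ℚ-ring

Deg≤-^ : ∀ j → Deg≤ j (_^ℚ j)
Deg≤-^ zero    = Deg≤-const 0 1ℚ
Deg≤-^ (suc j) = Deg≤-*x (Deg≤-^ j)

Deg≤-sumFin : ∀ {n} m {F : Fin m → ℚ → ℚ} → (∀ j → Deg≤ n (F j)) →
              Deg≤ n (λ x → sumFin m (λ j → F j x))
Deg≤-sumFin {n} zero    DF = Deg≤-const n 0ℚ
Deg≤-sumFin     (suc m) DF = Deg≤-+ (DF fzero) (Deg≤-sumFin m (DF ∘ fsuc))

sumFin-cong : ∀ m {f g : Fin m → ℚ} → f ≗ g → sumFin m f ≡ sumFin m g
sumFin-cong zero    f≗g = refl
sumFin-cong (suc m) f≗g = cong₂ _+_ (f≗g fzero) (sumFin-cong m (f≗g ∘ fsuc))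

evalPoly : (m : ℕ) → (Fin m → ℚ) → ℚ → ℚ
evalPoly m c x = sumFin m (λ j → c j * (x ^ℚ toℕ j))

Deg≤-evalPoly : ∀ d (c : Fin (suc d) → ℚ) → Deg≤ d (evalPoly (suc d) c)
Deg≤-evalPoly d c = Deg≤-sumFin (suc d) λ j →
  Deg≤-scale (c j) (Deg≤-mono (Fin.toℕ≤pred[n] j) (Deg≤-^ (toℕ j)))

-- Since −1 + 1 = 0, f (−1) = f 0 − Δ f (−1); recurse on Δ f.
Deg≤-agree-on-ℕ⇒agree-at-−1 : ∀ {n f g} → Deg≤ n f → Deg≤ n g →
  (∀ m → f (ℕ→ℚ m) ≡ g (ℕ→ℚ m)) → f (- 1ℚ) ≡ g (- 1ℚ)
Deg≤-agree-on-ℕ⇒agree-at-−1 {f = f} {g} Df Dg f≡g = begin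
  f (- 1ℚ)             ≡⟨ value-at-−1 f ⟩
  f 0ℚ - Δ f (- 1ℚ)    ≡⟨ cong₂ _-_ (f≡g 0) (Δ-agree Df Dg) ⟩
  g 0ℚ - Δ g (- 1ℚ)    ≡⟨ sym (value-at-−1 g) ⟩
  g (- 1ℚ)             ∎
  where
  value-at-−1 : ∀ h → h (- 1ℚ) ≡ h 0ℚ - Δ h (- 1ℚ)
  value-at-−1 h = lemma (h 0ℚ) (h (- 1ℚ))
    where
    lemma : ∀ a b → b ≡ a - (a - b)
    lemma = solve-∀ ℚ-ring
  Δf≡Δg-on-ℕ : ∀ m → Δ f (ℕ→ℚ m) ≡ Δ g (ℕ→ℚ m)
  Δf≡Δg-on-ℕ m = cong₂ _-_ (subst (λ y → f y ≡ g y) (ℕ→ℚ-suc m) (f≡g (suc m))) (f≡g m)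
  Δ-agree : ∀ {n} → Deg≤ n f → Deg≤ n g → Δ f (- 1ℚ) ≡ Δ g (- 1ℚ)
  Δ-agree (Δ-vanishes Δf≡0) (Δ-vanishes Δg≡0) = trans (Δf≡0 (- 1ℚ)) (sym (Δg≡0 (- 1ℚ)))
  Δ-agree (Δ-deg≤ DΔf)      (Δ-deg≤ DΔg)      = Deg≤-agree-on-ℕ⇒agree-at-−1 DΔf DΔg Δf≡Δg-on-ℕ

-- rising d x = d! · C(x + d, d)
rising : ℕ → ℚ → ℚ
rising zero    x = 1ℚ
rising (suc d) x = rising d x * (x + ℕ→ℚ (suc d))

-- The polynomial extension of n ↦ d! · P d k n for k ≤ d, read off from
-- (1 + x)^(k+1) = (1 + x)^k + x (1 + x)^k.
polyP : ℕ → ℕ → ℚ → ℚ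
polyP d zero    x = rising d x
polyP d (suc k) x = polyP d k x + polyP d k (x - 1ℚ)

Deg≤-rising : ∀ d → Deg≤ d (rising d)
Deg≤-rising zero    = Deg≤-const 0 1ℚ
Deg≤-rising (suc d) = Deg≤-*[x+ ℕ→ℚ (suc d) ] (Deg≤-rising d)

Deg≤-polyP : ∀ d k → Deg≤ d (polyP d k)
Deg≤-polyP d zero    = Deg≤-rising d
Deg≤-polyP d (suc k) = Deg≤-+ (Deg≤-polyP d k) (Deg≤-shift (- 1ℚ) (Deg≤-polyP d k))

rising-root : ∀ {d j} → j < d → rising d (- ℕ→ℚ (suc j)) ≡ 0ℚ
rising-root {suc d} {j} j<1+d with ℕ.m<1+n⇒m<n∨m≡n j<1+d
... | inj₁ j<d  = trans (cong (_* (x + ℕ→ℚ (suc d))) (rising-root j<d)) (*-zeroˡ (x + ℕ→ℚ (suc d)))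
  where x = - ℕ→ℚ (suc j)
... | inj₂ refl = trans (cong (rising j x *_) (+-inverseˡ (ℕ→ℚ (suc j)))) (*-zeroʳ (rising j x))
  where x = - ℕ→ℚ (suc j)

polyP-root : ∀ d k j → j +ℕ k < d → polyP d k (- ℕ→ℚ (suc j)) ≡ 0ℚ
polyP-root d zero    j j+0<d     = rising-root (subst (_< d) (ℕ.+-identityʳ j) j+0<d)
polyP-root d (suc k) j j+[k+1]<d = trans (cong₂ _+_ root₁ root₂) (+-identityʳ 0ℚ)
  where
  [j+1]+k<d : suc j +ℕ k < d
  [j+1]+k<d = subst (_< d) (ℕ.+-suc j k) j+[k+1]<d
  root₁ : polyP d k (- ℕ→ℚ (suc j)) ≡ 0ℚ
  root₁ = polyP-root d k j (ℕ.<⇒≤ [j+1]+k<d)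
  root₂ : polyP d k (- ℕ→ℚ (suc j) - 1ℚ) ≡ 0ℚ
  root₂ = trans (cong (polyP d k) (neg-ℕ→ℚ-1 (suc j))) (polyP-root d k (suc j) [j+1]+k<d)

sumUpTo-cong : ∀ n {f g} → f ≗ g → sumUpTo n f ≡ sumUpTo n g
sumUpTo-cong zero    f≗g = f≗g 0
sumUpTo-cong (suc n) f≗g = cong₂ _+ℕ_ (sumUpTo-cong n f≗g) (f≗g (suc n))

sumUpTo-+ : ∀ n f g → sumUpTo n (λ i → f i +ℕ g i) ≡ sumUpTo n f +ℕ sumUpTo n g
sumUpTo-+ zero    f g = refl
sumUpTo-+ (suc n) f g = begin
  sumUpTo n (λ i → f i +ℕ g i) +ℕ (f (suc n) +ℕ g (suc n))
    ≡⟨ cong (_+ℕ (f (suc n) +ℕ g (suc n))) (sumUpTo-+ n f g) ⟩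
  sumUpTo n f +ℕ sumUpTo n g +ℕ (f (suc n) +ℕ g (suc n))
    ≡⟨ +-interchange (sumUpTo n f) (sumUpTo n g) (f (suc n)) (g (suc n)) ⟩
  sumUpTo n f +ℕ f (suc n) +ℕ (sumUpTo n g +ℕ g (suc n))
    ∎

sumUpTo-suc : ∀ n f → sumUpTo (suc n) f ≡ f 0 +ℕ sumUpTo n (f ∘ suc)
sumUpTo-suc zero    f = refl
sumUpTo-suc (suc n) f = trans (cong (_+ℕ f (suc (suc n))) (sumUpTo-suc n f))
                              (ℕ.+-assoc (f 0) (sumUpTo n (f ∘ suc)) (f (suc (suc n))))

sumUpTo-const-0 : ∀ n → sumUpTo n (const 0) ≡ 0
sumUpTo-const-0 zero    = refl
sumUpTo-const-0 (suc n) = trans (ℕ.+-identityʳ _) (sumUpTo-const-0 n)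

mulX : Series → Series
mulX f zero    = 0
mulX f (suc n) = f n

mulX-cong : ∀ {f g} → f ≗ g → mulX f ≗ mulX g
mulX-cong f≗g zero    = refl
mulX-cong f≗g (suc n) = f≗g n

⊛-congˡ : ∀ {f f′} g → f ≗ f′ → f ⊛ g ≗ f′ ⊛ g
⊛-congˡ g f≗f′ n = sumUpTo-cong n (λ i → cong (_*ℕ g (n ∸ i)) (f≗f′ i))

⊛-identityˡ : ∀ g → oneS ⊛ g ≗ g
⊛-identityˡ g zero    = ℕ.+-identityʳ (g 0)
⊛-identityˡ g (suc n) = begin
  (oneS ⊛ g) (suc n)                                   ≡⟨ sumUpTo-suc n _ ⟩
  g (suc n) +ℕ 0 +ℕ sumUpTo n (λ i → 0 *ℕ g (n ∸ i))   ≡⟨ cong₂ _+ℕ_ (ℕ.+-identityʳ (g (suc n)))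
                                                                     (sumUpTo-const-0 n) ⟩
  g (suc n) +ℕ 0                                       ≡⟨ ℕ.+-identityʳ (g (suc n)) ⟩
  g (suc n)                                            ∎

⊛-distribʳ-+ : ∀ f g h → (λ i → f i +ℕ g i) ⊛ h ≗ (λ n → (f ⊛ h) n +ℕ (g ⊛ h) n)
⊛-distribʳ-+ f g h n =
  trans (sumUpTo-cong n (λ i → ℕ.*-distribʳ-+ (h (n ∸ i)) (f i) (g i)))
        (sumUpTo-+ n (λ i → f i *ℕ h (n ∸ i)) (λ i → g i *ℕ h (n ∸ i)))

mulX-⊛ : ∀ f g → mulX f ⊛ g ≗ mulX (f ⊛ g)
mulX-⊛ f g zero    = refl
mulX-⊛ f g (suc n) = sumUpTo-suc n (λ i → mulX f i *ℕ g (suc n ∸ i))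

onePlusX-⊛ : ∀ f → onePlusX ⊛ f ≗ (λ n → f n +ℕ mulX f n)
onePlusX-⊛ f n = begin
  (onePlusX ⊛ f) n                          ≡⟨ ⊛-congˡ f onePlusX≗1+x n ⟩
  ((λ i → oneS i +ℕ mulX oneS i) ⊛ f) n     ≡⟨ ⊛-distribʳ-+ oneS (mulX oneS) f n ⟩
  (oneS ⊛ f) n +ℕ (mulX oneS ⊛ f) n         ≡⟨ cong₂ _+ℕ_ (⊛-identityˡ f n) (mulX-⊛ oneS f n) ⟩
  f n +ℕ mulX (oneS ⊛ f) n                  ≡⟨ cong (f n +ℕ_) (mulX-cong (⊛-identityˡ f) n) ⟩
  f n +ℕ mulX f n                           ∎
  where
  onePlusX≗1+x : onePlusX ≗ (λ i → oneS i +ℕ mulX oneS i)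
  onePlusX≗1+x zero          = refl
  onePlusX≗1+x (suc zero)    = refl
  onePlusX≗1+x (suc (suc i)) = refl

geomS-⊛-suc : ∀ h n → (geomS ⊛ h) (suc n) ≡ h (suc n) +ℕ (geomS ⊛ h) n
geomS-⊛-suc h n = trans (sumUpTo-suc n (λ i → geomS i *ℕ h (suc n ∸ i)))
                        (cong (_+ℕ (geomS ⊛ h) n) (ℕ.*-identityˡ (h (suc n))))

geomS-⊛-oneS : ∀ n → (geomS ⊛ oneS) n ≡ 1
geomS-⊛-oneS zero    = refl
geomS-⊛-oneS (suc n) = trans (geomS-⊛-suc oneS n) (geomS-⊛-oneS n)

P-suc : ∀ d k n → P d (suc k) n ≡ P d k n +ℕ mulX (P d k) n
P-suc d k n = begin
  ((onePlusX ⊛ A) ⊛ B) n               ≡⟨ ⊛-congˡ B (onePlusX-⊛ A) n ⟩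
  ((λ i → A i +ℕ mulX A i) ⊛ B) n      ≡⟨ ⊛-distribʳ-+ A (mulX A) B n ⟩
  (A ⊛ B) n +ℕ (mulX A ⊛ B) n          ≡⟨ cong ((A ⊛ B) n +ℕ_) (mulX-⊛ A B n) ⟩
  P d k n +ℕ mulX (P d k) n            ∎
  where
  A = powS onePlusX k
  B = powS geomS (suc d)

rising-suc : ∀ d x → rising (suc d) x ≡ (x + 1ℚ) * rising d (x + 1ℚ)
rising-suc zero    x = trans (*-identityˡ (x + 1ℚ)) (sym (*-identityʳ (x + 1ℚ)))
rising-suc (suc d) x = begin
  rising (suc d) x * (x + ℕ→ℚ (suc (suc d)))
    ≡⟨ cong₂ _*_ (rising-suc d x) (cong (x +_) (ℕ→ℚ-suc (suc d))) ⟩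
  (x + 1ℚ) * rising d (x + 1ℚ) * (x + (ℕ→ℚ (suc d) + 1ℚ))
    ≡⟨ lemma x (ℕ→ℚ (suc d)) (rising d (x + 1ℚ)) ⟩
  (x + 1ℚ) * (rising d (x + 1ℚ) * (x + 1ℚ + ℕ→ℚ (suc d)))
    ∎
  where
  lemma : ∀ x c r → (x + 1ℚ) * r * (x + (c + 1ℚ)) ≡ (x + 1ℚ) * (r * (x + 1ℚ + c))
  lemma = solve-∀ ℚ-ring

-- powS geomS (suc d) n = C(n + d, d); the induction step is Pascal's rule, as in geomS-⊛-suc.
d!·geomS-pow≡rising : ∀ d n → ℕ→ℚ (d ! *ℕ powS geomS (suc d) n) ≡ rising d (ℕ→ℚ n)
d!·geomS-pow≡rising zero    n       = cong ℕ→ℚ (trans (ℕ.+-identityʳ _) (geomS-⊛-oneS n))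
d!·geomS-pow≡rising (suc e) zero    = begin
  ℕ→ℚ (suc e ! *ℕ (1 *ℕ B e 0))      ≡⟨ cong ℕ→ℚ (lemma (suc e) (e !) (B e 0)) ⟩
  ℕ→ℚ (suc e *ℕ (e ! *ℕ B e 0))      ≡⟨ ℕ→ℚ-* (suc e) (e ! *ℕ B e 0) ⟩
  c * ℕ→ℚ (e ! *ℕ B e 0)             ≡⟨ cong (c *_) (d!·geomS-pow≡rising e 0) ⟩
  c * rising e 0ℚ                    ≡⟨ *-comm c (rising e 0ℚ) ⟩
  rising e 0ℚ * c                    ≡⟨ cong (rising e 0ℚ *_) (sym (+-identityˡ c)) ⟩
  rising e 0ℚ * (0ℚ + c)             ∎
  where
  B = λ d → powS geomS (suc d)
  c = ℕ→ℚ (suc e)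
  lemma : ∀ a b x → a *ℕ b *ℕ (1 *ℕ x) ≡ a *ℕ (b *ℕ x)
  lemma = ℕ-Solver.solve-∀
d!·geomS-pow≡rising (suc e) (suc m) = begin
  ℕ→ℚ (suc e ! *ℕ B (suc e) (suc m))
    ≡⟨ cong (λ t → ℕ→ℚ (suc e ! *ℕ t)) (geomS-⊛-suc (B e) m) ⟩
  ℕ→ℚ (suc e ! *ℕ (B e (suc m) +ℕ B (suc e) m))
    ≡⟨ cong ℕ→ℚ (regroup (suc e) (e !) (B e (suc m)) (B (suc e) m)) ⟩
  ℕ→ℚ (suc e *ℕ (e ! *ℕ B e (suc m)) +ℕ suc e ! *ℕ B (suc e) m)
    ≡⟨ ℕ→ℚ-+ (suc e *ℕ (e ! *ℕ B e (suc m))) (suc e ! *ℕ B (suc e) m) ⟩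
  ℕ→ℚ (suc e *ℕ (e ! *ℕ B e (suc m))) + ℕ→ℚ (suc e ! *ℕ B (suc e) m)
    ≡⟨ cong (_+ ℕ→ℚ (suc e ! *ℕ B (suc e) m)) (ℕ→ℚ-* (suc e) (e ! *ℕ B e (suc m))) ⟩
  c * ℕ→ℚ (e ! *ℕ B e (suc m)) + ℕ→ℚ (suc e ! *ℕ B (suc e) m)
    ≡⟨ cong₂ _+_ (cong (c *_) (d!·geomS-pow≡rising e (suc m))) (d!·geomS-pow≡rising (suc e) m) ⟩
  c * rising e s + rising (suc e) (ℕ→ℚ m)
    ≡⟨ cong (c * rising e s +_) (rising-suc e (ℕ→ℚ m)) ⟩
  c * rising e s + (ℕ→ℚ m + 1ℚ) * rising e (ℕ→ℚ m + 1ℚ)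
    ≡⟨ cong (λ y → c * rising e s + y * rising e y) (sym (ℕ→ℚ-suc m)) ⟩
  c * rising e s + s * rising e s
    ≡⟨ factor c s (rising e s) ⟩
  rising e s * (s + c)
    ∎
  where
  B = λ d → powS geomS (suc d)
  c = ℕ→ℚ (suc e)
  s = ℕ→ℚ (suc m)
  regroup : ∀ a b x y → a *ℕ b *ℕ (x +ℕ y) ≡ a *ℕ (b *ℕ x) +ℕ a *ℕ b *ℕ y
  regroup = ℕ-Solver.solve-∀
  factor : ∀ c s r → c * r + s * r ≡ r * (s + c)
  factor = solve-∀ ℚ-ring

d!·P≡polyP : ∀ d k → k ≤ d → ∀ n → ℕ→ℚ (d ! *ℕ P d k n) ≡ polyP d k (ℕ→ℚ n)
d!·P≡polyP d zero _ n =
  trans (cong (λ t → ℕ→ℚ (d ! *ℕ t)) (⊛-identityˡ (powS geomS (suc d)) n))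
        (d!·geomS-pow≡rising d n)
d!·P≡polyP d (suc k) k<d n = begin
  ℕ→ℚ (d ! *ℕ P d (suc k) n)
    ≡⟨ cong (λ t → ℕ→ℚ (d ! *ℕ t)) (P-suc d k n) ⟩
  ℕ→ℚ (d ! *ℕ (P d k n +ℕ mulX (P d k) n))
    ≡⟨ cong ℕ→ℚ (ℕ.*-distribˡ-+ (d !) (P d k n) (mulX (P d k) n)) ⟩
  ℕ→ℚ (d ! *ℕ P d k n +ℕ d ! *ℕ mulX (P d k) n)
    ≡⟨ ℕ→ℚ-+ (d ! *ℕ P d k n) (d ! *ℕ mulX (P d k) n) ⟩
  ℕ→ℚ (d ! *ℕ P d k n) + ℕ→ℚ (d ! *ℕ mulX (P d k) n)
    ≡⟨ cong₂ _+_ (d!·P≡polyP d k (ℕ.<⇒≤ k<d) n) (x·P-term n) ⟩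
  polyP d k (ℕ→ℚ n) + polyP d k (ℕ→ℚ n - 1ℚ)
    ∎
  where
  -- At n = 0 the coefficient of x · P d k is 0, matching the root of polyP d k at −1.
  x·P-term : ∀ n → ℕ→ℚ (d ! *ℕ mulX (P d k) n) ≡ polyP d k (ℕ→ℚ n - 1ℚ)
  x·P-term zero    = trans (cong ℕ→ℚ (ℕ.*-zeroʳ (d !))) (sym (polyP-root d k 0 k<d))
  x·P-term (suc m) =
    trans (d!·P≡polyP d k (ℕ.<⇒≤ k<d) m) (cong (polyP d k) (sym (ℕ→ℚ-suc-1 m)))

proposition4p6 : (d k : ℕ) → 1 ≤ d → k < d →
    (c : Fin (suc d) → ℚ) → IsCoeffs d k c →
    sumFin (suc d) (λ j → ((- 1ℚ) ^ℚ toℕ j) * c j) ≡ 0ℚ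
proposition4p6 d k _ k<d c isCoeffs = begin
  sumFin (suc d) (λ j → ((- 1ℚ) ^ℚ toℕ j) * c j)
    ≡⟨ sumFin-cong (suc d) (λ j → *-comm ((- 1ℚ) ^ℚ toℕ j) (c j)) ⟩
  evalPoly (suc d) c (- 1ℚ)
    ≡⟨ Deg≤-agree-on-ℕ⇒agree-at-−1 (Deg≤-evalPoly d c) (Deg≤-polyP d k) agree ⟩
  polyP d k (- 1ℚ)
    ≡⟨ polyP-root d k 0 k<d ⟩
  0ℚ
    ∎
  where
  agree : ∀ n → evalPoly (suc d) c (ℕ→ℚ n) ≡ polyP d k (ℕ→ℚ n)
  agree n = trans (sym (isCoeffs n)) (d!·P≡polyP d k (ℕ.<⇒≤ k<d) n)
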